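{- Let $G$ be a finite cyclic group. For each $m\in I(|G|)$ there exists a subset $G_0\subseteq G$ containing exactly two generating elements of $G$ such that $\min\Delta(G_0)=m$. More precisely, for $(c_1,c_2,d)\in M(|G|)$ and $e$ a generating element of $G$, the element $g=\frac{|G|-c_1}{c_2}e$ is another generating element of $G$, and \[\min\Delta\left(\left\{e,\tfrac{|G|-c_1}{c_2}e,de\right\}\right)=\gcd\left\{\frac{|G|-c_1-c_2}{c_1c_2},\ \frac{(|G|-c_1-c_2)d}{c_2|G|}\right\}.\]
   Context: For $G_0\subseteq G$: $\mathcal B(G_0)$ is the monoid of zero-sum sequences over $G_0$ (finite unordered lists of elements of $G_0$ with sum $0$), whose atoms are the minimal zero-sum sequences; $\mathsf L(B)$ is the set of lengths of factorizations of $B$ into minimal zero-sum sequences; for $L=\{\ell_1<\dots<\ell_k\}$, $\Delta(L)=\{\ell_{i+1}-\ell_i\}$; $\Delta(G_0)=\bigcup_B\Delta(\mathsf L(B))$; $\min\Delta(G_0)$ is its minimum, with $\min\emptyset=0$. For a positive integer $n$: $M(n)$ is the set of triples $(c_1,c_2,d)$ of positive integers with $c_1,c_2\in[1,n]$, $d\mid n$, such that $\frac{n-c_1-c_2}{c_1c_2}$ and $\frac{(n-c_1-c_2)d}{c_2n}$ are positive integers; $I(n)$ is the set of all integers $\gcd\left\{\frac{n-c_1-c_2}{c_1c_2},\frac{(n-c_1-c_2)d}{c_2n}\right\}$ with $(c_1,c_2,d)\in M(n)$. -}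

module Defs where

open import Data.Nat using (ℕ; zero; suc; _+_; _*_; _∸_; _≤_; _<_; NonZero)
open import Data.Nat.DivMod using (_/_; _%_)
open import Data.Nat.Divisibility using (_∣_)
open import Data.Nat.GCD using (gcd)
open import Data.List using (List; []; _∷_; length; concat)
open import Data.Nat.ListAction using (sum)
open import Data.List.Relation.Unary.All using (All)
open import Data.List.Membership.Propositional using (_∈_)
open import Data.List.Relation.Binary.Sublist.Propositional using (_⊆_)
open import Data.List.Relation.Binary.Permutation.Propositional using (_↭_)
open import Data.Product using (Σ; _×_)
open import Data.Sum using (_⊎_)
open import Relation.Binary.PropositionalEquality using (_≡_; _≢_)
open import Relation.Nullary using (¬_)

-- The finite cyclic group G of order n ≥ 1 is modelled as ℤ/nℤ, its
-- elements being represented by the residues 0,…,n-1 (natural numbers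
-- < n), with the group operation being addition modulo n.

InG : ℕ → ℕ → Set
InG n x = x < n

-- A subset G₀ ⊆ G, given by a list of its elements (order and
-- repetitions are irrelevant; only membership _∈_ is ever used).
IsSubset : ℕ → List ℕ → Set
IsSubset n G₀ = All (InG n) G₀

mul : (n : ℕ) .{{_ : NonZero n}} → ℕ → ℕ → ℕ
mul n k x = (k * x) % n

IsGen : ℕ → ℕ → Set
IsGen n g = g < n × gcd g n ≡ 1

ExactlyTwoGens : ℕ → List ℕ → Set
ExactlyTwoGens n G₀ =
  Σ ℕ λ g₁ → Σ ℕ λ g₂ →
    g₁ ≢ g₂ × g₁ ∈ G₀ × g₂ ∈ G₀ × IsGen n g₁ × IsGen n g₂ ×
    (∀ g → g ∈ G₀ → IsGen n g → g ≡ g₁ ⊎ g ≡ g₂)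

-- Sequences over G₀ are finite unordered lists: represented by lists,
-- considered up to permutation (_↭_).

SeqOver : List ℕ → List ℕ → Set
SeqOver G₀ S = All (_∈ G₀) S

ZeroSum : ℕ → List ℕ → Set
ZeroSum n S = n ∣ sum S

InB : ℕ → List ℕ → List ℕ → Set
InB n G₀ S = SeqOver G₀ S × ZeroSum n S

NonEmpty : List ℕ → Set
NonEmpty S = 1 ≤ length S

-- A is an atom of 𝓑(G₀): a minimal zero-sum sequence over G₀, i.e. a
-- nonempty zero-sum sequence over G₀ every nonempty zero-sum
-- subsequence of which is A itself.  (Subsequences of the sequence
-- represented by the list A are exactly the sublists of A.)
IsAtom : ℕ → List ℕ → List ℕ → Set
IsAtom n G₀ A =
  InB n G₀ A × NonEmpty A ×
  (∀ T → T ⊆ A → NonEmpty T → ZeroSum n T → length T ≡ length A)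

-- ℓ ∈ 𝖫(B): B has a factorization into ℓ atoms of 𝓑(G₀)
-- (the product of the atoms, i.e. their concatenation, equals B up to
-- reordering).
InL : ℕ → List ℕ → List ℕ → ℕ → Set
InL n G₀ B ℓ =
  Σ (List (List ℕ)) λ fs →
    All (IsAtom n G₀) fs × concat fs ↭ B × length fs ≡ ℓ

InΔ : (ℕ → Set) → ℕ → Set
InΔ L d =
  Σ ℕ λ ℓ → L ℓ × L (ℓ + d) × 1 ≤ d ×
    (∀ k → ℓ < k → k < ℓ + d → ¬ L k)

InΔG : ℕ → List ℕ → ℕ → Set
InΔG n G₀ d = Σ (List ℕ) λ B → InB n G₀ B × InΔ (InL n G₀ B) d

-- min Δ(G₀) = m, with the convention min ∅ = 0
IsMinΔ : ℕ → List ℕ → ℕ → Set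
IsMinΔ n G₀ m =
  (m ≡ 0 × (∀ d → ¬ InΔG n G₀ d))
  ⊎ (InΔG n G₀ m × (∀ d → InΔG n G₀ d → m ≤ d))

-- natural-number division with the convention a div 0 = 0 (only ever
-- applied to positive divisors below)
_div_ : ℕ → ℕ → ℕ
a div zero = 0
a div suc b = a / suc b

-- a / b is a positive integer (for b > 0; a is a truncated difference,
-- which is 0 exactly when the true difference is ≤ 0, and then a / b is
-- not positive)
PosIntQuot : ℕ → ℕ → Set
PosIntQuot a b = Σ ℕ λ q → 1 ≤ q × q * b ≡ a

InM : ℕ → ℕ → ℕ → ℕ → Set
InM n c₁ c₂ d =
  (1 ≤ c₁ × c₁ ≤ n) × (1 ≤ c₂ × c₂ ≤ n) × (1 ≤ d × d ∣ n) ×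
  PosIntQuot (n ∸ c₁ ∸ c₂) (c₁ * c₂) ×
  PosIntQuot ((n ∸ c₁ ∸ c₂) * d) (c₂ * n)

gcdM : ℕ → ℕ → ℕ → ℕ → ℕ
gcdM n c₁ c₂ d =
  gcd ((n ∸ c₁ ∸ c₂) div (c₁ * c₂)) (((n ∸ c₁ ∸ c₂) * d) div (c₂ * n))

InI : ℕ → ℕ → Set
InI n m = Σ ℕ λ c₁ → Σ ℕ λ c₂ → Σ ℕ λ d → InM n c₁ c₂ d × m ≡ gcdM n c₁ c₂ d

module Submission where

-- Proposition 6.3.  Write (c₁, c₂, d) ∈ M(n) as n = c₁ + c₂ + q₁c₁c₂,
-- q₂n = q₁c₁d and n = td, so that gcdM = m := gcd q₁ q₂, and put
-- k = (n - c₁)/c₂ = 1 + q₁c₁ and k' = 1 + q₁c₂, an inverse of k modulo n.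
-- For a generator e the set is G₀ = {e, ke, de}.
--
-- 1. Sequences over a three-element set are determined by multiplicity
--    vectors (a, b, c); as e generates, e^a (ke)^b (de)^c is zero-sum iff
--    n divides its weight a + kb + dc.  Atoms and factorizations thus
--    become arithmetic on vectors (ThreeElementSequences, Setting).
-- 2. Lower bound: every atom has weight sn with s ≡ 1 (mod m), by a case
--    analysis whose main case uses the key lemma (n ∣ a + kB with a < c₁,
--    B ≤ n forces B + k'a = n).  Summing over a factorization, all lengths
--    of a sequence are congruent mod m, so Δ(G₀) consists of multiples of m.
-- 3. Upper bound: two explicit trades between factorizations, with length
--    differences q₁ and q₂, combine along a Bézout identity for gcd q₁ q₂
--    into factorizations of lengths ℓ and ℓ + m, so m ∈ Δ(G₀).
-- 4. ke generates (k is a unit) while de does not (2 ≤ d ∣ n); the first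
--    part of the theorem is the second one for e = 1.

open import Defs
open import Data.Nat using (ℕ; _∸_; NonZero)
open import Data.List using (List; []; _∷_)
open import Data.Product using (Σ; _×_)

open import Data.Nat.Base using (zero; suc; _+_; _*_; _≤_; _<_; z≤n; s≤s; s≤s⁻¹; z<s; >-nonZero; >-nonZero⁻¹; ≢-nonZero⁻¹)
open import Data.Nat.Properties
open import Data.Nat.DivMod using (_%_; _/_; m≡m%n+[m/n]*n; m%n<n; m<n⇒m%n≡m; m*n/n≡m)
open import Data.Nat.Divisibility using (_∣_; divides; ∣⇒≤; ∣m∣n⇒∣m+n; >⇒∤; ∣m+n∣m⇒∣n; n∣m*n; m∣m*n; ∣m⇒∣m*n; ∣n⇒∣m*n; ∣1⇒≡1; ∣-refl; ∣-trans; ∣n∣m%n⇒∣m)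
open import Data.Nat.GCD using (gcd; gcd-zeroˡ; gcd[m,n]∣m; gcd[m,n]∣n; gcd-greatest; gcd[m,n]≢0; gcd-GCD; module Bézout)
open import Data.Nat.Coprimality using (Coprime; gcd≡1⇒coprime; coprime⇒gcd≡1; coprime-divisor)
import Data.Nat.Coprimality as Coprime
open import Data.Nat.Tactic.RingSolver using (solve-∀)
import Algebra.Properties.CommutativeSemigroup as CSProps
module +-CS = CSProps +-commutativeSemigroup
module *-CS = CSProps *-commutativeSemigroup
open import Data.List.Base using (_++_; replicate; concat; length; map; foldr)
open import Data.List.Relation.Unary.All using (All; []; _∷_)
open import Data.List.Relation.Unary.All.Properties using (++⁺; replicate⁺; concat⁺)
import Data.List.Relation.Unary.All.Properties as All
open import Data.List.Relation.Unary.Any using (here; there)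
open import Data.List.Membership.Propositional using (_∈_)
open import Data.List.Relation.Binary.Sublist.Propositional using (_⊆_; []; _∷_; _∷ʳ_)
open import Data.List.Relation.Binary.Sublist.Propositional.Properties using (All-resp-⊆)
open import Data.Nat.ListAction using (sum)
open import Data.List.Relation.Binary.Permutation.Propositional using (_↭_; ↭-refl; ↭-trans; ↭-reflexive; ↭-sym; prep; swap)
import Data.List.Relation.Binary.Permutation.Propositional as Perm
import Data.List.Relation.Binary.Permutation.Propositional.Properties as ↭
import Data.List.Properties as List
open import Data.Product using (_,_; ∃₂)
open import Data.Empty using (⊥-elim)
open import Data.Sum using (_⊎_; inj₁; inj₂)
open import Relation.Binary.Definitions using (tri<; tri≈; tri>)
open import Relation.Nullary using (¬_; yes; no)
open import Relation.Binary.PropositionalEquality using (_≡_; _≢_; refl; sym; trans; cong; cong₂; subst; subst₂; module ≡-Reasoning)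

multiple-below-double : ∀ {n x} → n ∣ x → 0 < x → x < n + n → x ≡ n
multiple-below-double (divides zero refl) () _
multiple-below-double (divides (suc zero) refl) _ _ = +-identityʳ _
multiple-below-double {n} (divides (suc (suc q)) refl) _ x<2n =
  ⊥-elim (<-irrefl refl (<-≤-trans x<2n (+-monoʳ-≤ n (m≤m+n n (q * n)))))

multiple-at-most : ∀ {n x} → n ∣ x → 0 < x → x ≤ n → x ≡ n
multiple-at-most {n} n∣x 0<x x≤n =
  multiple-below-double n∣x 0<x (≤-<-trans x≤n (m<m+n n (<-≤-trans 0<x x≤n)))

∤-between : ∀ {n x} → 0 < x → x < n → ¬ (n ∣ x)
∤-between 0<x x<n = >⇒∤ {{>-nonZero 0<x}} x<n

%-shift⇒∣ : ∀ n .{{_ : NonZero n}} a b → a % n ≡ (b + a) % n → n ∣ b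
%-shift⇒∣ n a b same = ∣m+n∣m⇒∣n (subst (n ∣_) [b+a]/n*n≡ (n∣m*n ((b + a) / n))) (n∣m*n (a / n))
  where
  open ≡-Reasoning
  [b+a]/n*n≡ : (b + a) / n * n ≡ a / n * n + b
  [b+a]/n*n≡ = +-cancelˡ-≡ (a % n) ((b + a) / n * n) (a / n * n + b) (begin
    a % n + (b + a) / n * n       ≡⟨ cong (_+ (b + a) / n * n) same ⟩
    (b + a) % n + (b + a) / n * n ≡⟨ m≡m%n+[m/n]*n (b + a) n ⟨
    b + a                         ≡⟨ cong (b +_) (m≡m%n+[m/n]*n a n) ⟩
    b + (a % n + a / n * n)       ≡⟨ +-CS.x∙yz≈y∙zx b (a % n) (a / n * n) ⟩
    a % n + (a / n * n + b)       ∎)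

-- Congruence modulo m, phrased without subtraction.
infix 4 _≡_[mod_]
_≡_[mod_] : ℕ → ℕ → ℕ → Set
x ≡ y [mod m ] = ∃₂ λ u v → x + u * m ≡ y + v * m

≡-mod-sym : ∀ {m x y} → x ≡ y [mod m ] → y ≡ x [mod m ]
≡-mod-sym (u , v , eq) = v , u , sym eq

≡-mod-trans : ∀ {m x y z} → x ≡ y [mod m ] → y ≡ z [mod m ] → x ≡ z [mod m ]
≡-mod-trans {m} {x} {y} {z} (u , v , x≡y) (u' , v' , y≡z) = u + u' , v' + v , (begin
  x + (u + u') * m       ≡⟨ split x u u' ⟩
  (x + u * m) + u' * m   ≡⟨ cong (_+ u' * m) x≡y ⟩
  (y + v * m) + u' * m   ≡⟨ +-CS.xy∙z≈xz∙y y (v * m) (u' * m) ⟩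
  (y + u' * m) + v * m   ≡⟨ cong (_+ v * m) y≡z ⟩
  (z + v' * m) + v * m   ≡⟨ split z v' v ⟨
  z + (v' + v) * m       ∎)
  where
  open ≡-Reasoning
  split : ∀ a b c → a + (b + c) * m ≡ (a + b * m) + c * m
  split a b c = trans (cong (a +_) (*-distribʳ-+ m b c)) (sym (+-assoc a (b * m) (c * m)))

≡-mod-+ : ∀ {m x y x' y'} → x ≡ y [mod m ] → x' ≡ y' [mod m ] → x + x' ≡ y + y' [mod m ]
≡-mod-+ {m} {x} {y} {x'} {y'} (u , v , x≡y) (u' , v' , x'≡y') =
  u + u' , v + v' , trans (regroup x x' u u') (trans (cong₂ _+_ x≡y x'≡y') (sym (regroup y y' v v')))
  where
  regroup : ∀ a b c d → (a + b) + (c + d) * m ≡ (a + c * m) + (b + d * m)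
  regroup a b c d = trans (cong ((a + b) +_) (*-distribʳ-+ m c d)) (+-CS.interchange a b (c * m) (d * m))

≡-mod-intro : ∀ {m x y a b} → x + a ≡ y + b → m ∣ a → m ∣ b → x ≡ y [mod m ]
≡-mod-intro x+a≡y+b (divides α refl) (divides β refl) = α , β , x+a≡y+b

≡-mod-shift⇒∣ : ∀ {m ℓ δ} → ℓ ≡ ℓ + δ [mod m ] → m ∣ δ
≡-mod-shift⇒∣ {m} {ℓ} {δ} (u , v , eq) = divides (u ∸ v) (begin
  δ                   ≡⟨ m+n∸n≡m δ (v * m) ⟨
  δ + v * m ∸ v * m   ≡⟨ cong (_∸ v * m) um≡δ+vm ⟨
  u * m ∸ v * m       ≡⟨ *-distribʳ-∸ m u v ⟨
  (u ∸ v) * m         ∎)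
  where
  open ≡-Reasoning
  um≡δ+vm : u * m ≡ δ + v * m
  um≡δ+vm = +-cancelˡ-≡ ℓ _ _ (trans eq (+-assoc ℓ δ (v * m)))

-- Multiplicity vectors (a , b , c): how often each of three fixed
-- elements occurs in a sequence over them.
Mult : Set
Mult = ℕ × ℕ × ℕ

infixl 6 _⊕_
_⊕_ : Mult → Mult → Mult
(a , b , c) ⊕ (a' , b' , c') = a + a' , b + b' , c + c'

infixl 7 _⊛_
_⊛_ : ℕ → Mult → Mult
r ⊛ (a , b , c) = r * a , r * b , r * c

𝟘 : Mult
𝟘 = 0 , 0 , 0

size : Mult → ℕ
size (a , b , c) = a + b + c

lin : ℕ → ℕ → Mult → ℕ
lin β γ (a , b , c) = a + β * b + γ * c

infix 4 _≤ₘ_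
_≤ₘ_ : Mult → Mult → Set
(a , b , c) ≤ₘ (a' , b' , c') = a ≤ a' × b ≤ b' × c ≤ c'

sumₘ : List Mult → Mult
sumₘ = foldr _⊕_ 𝟘

mult-≡ : ∀ {a b c a' b' c' : ℕ} → a ≡ a' → b ≡ b' → c ≡ c' →
  _≡_ {A = Mult} (a , b , c) (a' , b' , c')
mult-≡ refl refl refl = refl

⊕-assoc : ∀ u v w → u ⊕ v ⊕ w ≡ u ⊕ (v ⊕ w)
⊕-assoc (a , b , c) (a' , b' , c') (a'' , b'' , c'') =
  mult-≡ (+-assoc a a' a'') (+-assoc b b' b'') (+-assoc c c' c'')

⊕-comm : ∀ u v → u ⊕ v ≡ v ⊕ u
⊕-comm (a , b , c) (a' , b' , c') = mult-≡ (+-comm a a') (+-comm b b') (+-comm c c')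

⊕-identityʳ : ∀ v → v ⊕ 𝟘 ≡ v
⊕-identityʳ (a , b , c) = mult-≡ (+-identityʳ a) (+-identityʳ b) (+-identityʳ c)

size-⊕ : ∀ u v → size (u ⊕ v) ≡ size u + size v
size-⊕ (a , b , c) (a' , b' , c') = regroup a b c a' b' c'
  where
  regroup : ∀ a b c a' b' c' → a + a' + (b + b') + (c + c') ≡ a + b + c + (a' + b' + c')
  regroup = solve-∀

lin-⊕ : ∀ β γ u v → lin β γ (u ⊕ v) ≡ lin β γ u + lin β γ v
lin-⊕ β γ (a , b , c) (a' , b' , c') = distribute β γ a b c a' b' c'
  where
  distribute : ∀ β γ a b c a' b' c' →
    a + a' + β * (b + b') + γ * (c + c') ≡ a + β * b + γ * c + (a' + β * b' + γ * c')
  distribute = solve-∀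

lin-𝟘 : ∀ β γ → lin β γ 𝟘 ≡ 0
lin-𝟘 β γ = cong₂ _+_ (*-zeroʳ β) (*-zeroʳ γ)

lin-first : ∀ β γ → lin β γ (1 , 0 , 0) ≡ 1
lin-first β γ = cong₂ _+_ (cong (1 +_) (*-zeroʳ β)) (*-zeroʳ γ)

lin-second : ∀ β γ → lin β γ (0 , 1 , 0) ≡ β
lin-second β γ = trans (cong₂ _+_ (*-identityʳ β) (*-zeroʳ γ)) (+-identityʳ β)

lin-third : ∀ β γ → lin β γ (0 , 0 , 1) ≡ γ
lin-third β γ = cong₂ _+_ (*-zeroʳ β) (*-identityʳ γ)

≤ₘ-refl : ∀ {u} → u ≤ₘ u
≤ₘ-refl = ≤-refl , ≤-refl , ≤-refl

≤ₘ-⊕ˡ : ∀ w {u v} → u ≤ₘ v → u ≤ₘ w ⊕ v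
≤ₘ-⊕ˡ (a , b , c) (p , q , r) = m≤n⇒m≤o+n a p , m≤n⇒m≤o+n b q , m≤n⇒m≤o+n c r

⊕-monoʳ-≤ₘ : ∀ w {u v} → u ≤ₘ v → w ⊕ u ≤ₘ w ⊕ v
⊕-monoʳ-≤ₘ (a , b , c) (p , q , r) = +-monoʳ-≤ a p , +-monoʳ-≤ b q , +-monoʳ-≤ c r

-- Pointwise comparable vectors with the same positively weighted count
-- are equal: a strict inequality in any coordinate would make the
-- smaller count strictly smaller.
≤ₘ-lin-injective : ∀ β γ .{{_ : NonZero β}} .{{_ : NonZero γ}} {u v} →
  u ≤ₘ v → lin β γ u ≡ lin β γ v → u ≡ v
≤ₘ-lin-injective β γ {a , b , c} {a' , b' , c'} (a≤ , b≤ , c≤) same = mult-≡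
  (≤∧≮⇒≡ a≤ λ a< → <-irrefl same
    (+-mono-<-≤ (+-mono-<-≤ a< (*-monoʳ-≤ β b≤)) (*-monoʳ-≤ γ c≤)))
  (≤∧≮⇒≡ b≤ λ b< → <-irrefl same
    (+-mono-<-≤ (+-mono-≤-< a≤ (*-monoʳ-< β b<)) (*-monoʳ-≤ γ c≤)))
  (≤∧≮⇒≡ c≤ λ c< → <-irrefl same
    (+-mono-≤-< (+-mono-≤ a≤ (*-monoʳ-≤ β b≤)) (*-monoʳ-< γ c<)))

≤ₘ-size-injective : ∀ {u v} → u ≤ₘ v → size u ≡ size v → u ≡ v
≤ₘ-size-injective {u} {v} u≤v same =
  ≤ₘ-lin-injective 1 1 u≤v (trans (lin-1-1 u) (trans same (sym (lin-1-1 v))))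
  where
  lin-1-1 : ∀ w → lin 1 1 w ≡ size w
  lin-1-1 (a , b , c) = cong₂ _+_ (cong (a +_) (*-identityˡ b)) (*-identityˡ c)

sumₘ-++ : ∀ us vs → sumₘ (us ++ vs) ≡ sumₘ us ⊕ sumₘ vs
sumₘ-++ [] vs = refl
sumₘ-++ (u ∷ us) vs = trans (cong (u ⊕_) (sumₘ-++ us vs)) (sym (⊕-assoc u (sumₘ us) (sumₘ vs)))

sumₘ-replicate : ∀ r v → sumₘ (replicate r v) ≡ r ⊛ v
sumₘ-replicate zero v = refl
sumₘ-replicate (suc r) v = cong (v ⊕_) (sumₘ-replicate r v)

lin-mono : ∀ β γ {u v} → u ≤ₘ v → lin β γ u ≤ lin β γ v
lin-mono β γ (a≤ , b≤ , c≤) = +-mono-≤ (+-mono-≤ a≤ (*-monoʳ-≤ β b≤)) (*-monoʳ-≤ γ c≤)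

size≤lin : ∀ β γ .{{_ : NonZero β}} .{{_ : NonZero γ}} v → size v ≤ lin β γ v
size≤lin β γ (a , b , c) = +-mono-≤ (+-monoʳ-≤ a (m≤n*m b β)) (m≤n*m c γ)

copies : ℕ → List Mult → List Mult
copies x vs = concat (replicate x vs)

sumₘ-copies : ∀ x vs → sumₘ (copies x vs) ≡ x ⊛ sumₘ vs
sumₘ-copies zero    vs = refl
sumₘ-copies (suc x) vs = trans (sumₘ-++ vs (copies x vs)) (cong (sumₘ vs ⊕_) (sumₘ-copies x vs))

length-copies : ∀ x (vs : List Mult) → length (copies x vs) ≡ x * length vs
length-copies zero    vs = refl
length-copies (suc x) vs = trans (List.length-++ vs) (cong (length vs +_) (length-copies x vs))

-- Such a
-- sequence is determined up to order by its multiplicity vector, so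
-- subsequences, products and factorizations become arithmetic on Mult.
module ThreeElementSequences (e g h : ℕ) (e≢g : e ≢ g) (e≢h : e ≢ h) (g≢h : g ≢ h) where

  G₀ : List ℕ
  G₀ = e ∷ g ∷ h ∷ []

  data IsUnit : Mult → Set where
    first  : IsUnit (1 , 0 , 0)
    second : IsUnit (0 , 1 , 0)
    third  : IsUnit (0 , 0 , 1)

  -- The multiplicity vector of the one-term sequence x (terms outside
  -- {e, g} are counted as h; only sequences over G₀ matter).
  unit : ℕ → Mult
  unit x with x ≟ e | x ≟ g
  ... | yes _ | _     = 1 , 0 , 0
  ... | no _  | yes _ = 0 , 1 , 0
  ... | no _  | no _  = 0 , 0 , 1

  unit-isUnit : ∀ x → IsUnit (unit x)
  unit-isUnit x with x ≟ e | x ≟ g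
  ... | yes _ | _     = first
  ... | no _  | yes _ = second
  ... | no _  | no _  = third

  unit-e : unit e ≡ (1 , 0 , 0)
  unit-e with e ≟ e
  ... | yes _ = refl
  ... | no e≢e = ⊥-elim (e≢e refl)

  unit-g : unit g ≡ (0 , 1 , 0)
  unit-g with g ≟ e | g ≟ g
  ... | yes g≡e | _     = ⊥-elim (e≢g (sym g≡e))
  ... | no _    | yes _ = refl
  ... | no _    | no g≢g = ⊥-elim (g≢g refl)

  unit-h : unit h ≡ (0 , 0 , 1)
  unit-h with h ≟ e | h ≟ g
  ... | yes h≡e | _     = ⊥-elim (e≢h (sym h≡e))
  ... | no _    | yes h≡g = ⊥-elim (g≢h (sym h≡g))
  ... | no _    | no _  = refl

  mult : List ℕ → Mult
  mult []       = 𝟘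
  mult (x ∷ xs) = unit x ⊕ mult xs

  size-mult : ∀ xs → size (mult xs) ≡ length xs
  size-mult []       = refl
  size-mult (x ∷ xs) = trans (size-⊕ (unit x) (mult xs)) (cong₂ _+_ (size-unit (unit-isUnit x)) (size-mult xs))
    where
    size-unit : ∀ {v} → IsUnit v → size v ≡ 1
    size-unit first  = refl
    size-unit second = refl
    size-unit third  = refl

  mult-++ : ∀ xs ys → mult (xs ++ ys) ≡ mult xs ⊕ mult ys
  mult-++ []       ys = refl
  mult-++ (x ∷ xs) ys = trans (cong (unit x ⊕_) (mult-++ xs ys)) (sym (⊕-assoc (unit x) (mult xs) (mult ys)))

  mult-↭ : ∀ {xs ys} → xs ↭ ys → mult xs ≡ mult ys
  mult-↭ Perm.refl = refl
  mult-↭ (prep x p) = cong (unit x ⊕_) (mult-↭ p)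
  mult-↭ (swap {xs} {ys} x y p) = begin
    unit x ⊕ (unit y ⊕ mult xs) ≡⟨ ⊕-assoc (unit x) (unit y) (mult xs) ⟨
    unit x ⊕ unit y ⊕ mult xs   ≡⟨ cong₂ _⊕_ (⊕-comm (unit x) (unit y)) (mult-↭ p) ⟩
    unit y ⊕ unit x ⊕ mult ys   ≡⟨ ⊕-assoc (unit y) (unit x) (mult ys) ⟩
    unit y ⊕ (unit x ⊕ mult ys) ∎
    where open ≡-Reasoning
  mult-↭ (Perm.trans p q) = trans (mult-↭ p) (mult-↭ q)

  mult-⊆ : ∀ {xs ys} → xs ⊆ ys → mult xs ≤ₘ mult ys
  mult-⊆ [] = ≤ₘ-refl
  mult-⊆ (y ∷ʳ p) = ≤ₘ-⊕ˡ (unit y) (mult-⊆ p)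
  mult-⊆ (_∷_ {x = x} refl p) = ⊕-monoʳ-≤ₘ (unit x) (mult-⊆ p)

  extract : ∀ ys u → u ≤ₘ mult ys → Σ (List ℕ) λ xs → xs ⊆ ys × mult xs ≡ u
  extract [] (zero , zero , zero) _ = [] , [] , refl
  extract (y ∷ ys) u u≤ = pick (unit-isUnit y) refl u u≤
    where
    keep : ∀ {v w} → unit y ≡ v → Σ (List ℕ) (λ xs → xs ⊆ ys × mult xs ≡ w) →
           Σ (List ℕ) λ xs → xs ⊆ y ∷ ys × mult xs ≡ v ⊕ w
    keep y↦v (xs , p , xs↦w) = y ∷ xs , refl ∷ p , cong₂ _⊕_ y↦v xs↦w
    skip : ∀ {w} → Σ (List ℕ) (λ xs → xs ⊆ ys × mult xs ≡ w) →
           Σ (List ℕ) λ xs → xs ⊆ y ∷ ys × mult xs ≡ w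
    skip (xs , p , xs↦w) = xs , y ∷ʳ p , xs↦w
    pick : ∀ {v} → IsUnit v → unit y ≡ v → ∀ u → u ≤ₘ v ⊕ mult ys →
           Σ (List ℕ) λ xs → xs ⊆ y ∷ ys × mult xs ≡ u
    pick first  y↦v (zero , b , c)  (_ , b≤ , c≤)      = skip (extract ys _ (z≤n , b≤ , c≤))
    pick first  y↦v (suc a , b , c) (s≤s a≤ , b≤ , c≤) = keep y↦v (extract ys _ (a≤ , b≤ , c≤))
    pick second y↦v (a , zero , c)  (a≤ , _ , c≤)      = skip (extract ys _ (a≤ , z≤n , c≤))
    pick second y↦v (a , suc b , c) (a≤ , s≤s b≤ , c≤) = keep y↦v (extract ys _ (a≤ , b≤ , c≤))
    pick third  y↦v (a , b , zero)  (a≤ , b≤ , _)      = skip (extract ys _ (a≤ , b≤ , z≤n))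
    pick third  y↦v (a , b , suc c) (a≤ , b≤ , s≤s c≤) = keep y↦v (extract ys _ (a≤ , b≤ , c≤))

  seq : Mult → List ℕ
  seq (a , b , c) = replicate a e ++ replicate b g ++ replicate c h

  mult-seq : ∀ v → mult (seq v) ≡ v
  mult-seq (a , b , c) = begin
    mult (replicate a e ++ replicate b g ++ replicate c h)
      ≡⟨ trans (mult-++ (replicate a e) _) (cong (mult (replicate a e) ⊕_) (mult-++ (replicate b g) _)) ⟩
    mult (replicate a e) ⊕ (mult (replicate b g) ⊕ mult (replicate c h))
      ≡⟨ cong₂ _⊕_ (mult-replicate unit-e a) (cong₂ _⊕_ (mult-replicate unit-g b) (mult-replicate unit-h c)) ⟩
    a ⊛ (1 , 0 , 0) ⊕ (b ⊛ (0 , 1 , 0) ⊕ c ⊛ (0 , 0 , 1))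
      ≡⟨ mult-≡ (first-coordinate a b c) (second-coordinate a b c) (third-coordinate a b c) ⟩
    (a , b , c) ∎
    where
    open ≡-Reasoning
    mult-replicate : ∀ {x v} → unit x ≡ v → ∀ r → mult (replicate r x) ≡ r ⊛ v
    mult-replicate x↦v zero    = refl
    mult-replicate x↦v (suc r) = cong₂ _⊕_ x↦v (mult-replicate x↦v r)
    first-coordinate : ∀ x y z → x * 1 + (y * 0 + z * 0) ≡ x
    first-coordinate = solve-∀
    second-coordinate : ∀ x y z → x * 0 + (y * 1 + z * 0) ≡ y
    second-coordinate = solve-∀
    third-coordinate : ∀ x y z → x * 0 + (y * 0 + z * 1) ≡ z
    third-coordinate = solve-∀

  seq-over-G₀ : ∀ v → All (_∈ G₀) (seq v)
  seq-over-G₀ (a , b , c) =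
    ++⁺ (replicate⁺ a (here refl)) (++⁺ (replicate⁺ b (there (here refl))) (replicate⁺ c (there (there (here refl)))))

  length-seq : ∀ v → length (seq v) ≡ size v
  length-seq v = trans (sym (size-mult (seq v))) (cong size (mult-seq v))

  seq-⊕ : ∀ u v → seq u ++ seq v ↭ seq (u ⊕ v)
  seq-⊕ (a , b , c) (a' , b' , c') = ↭-trans
    (interleave (replicate a e) (replicate b g) (replicate c h) (replicate a' e) (replicate b' g) (replicate c' h))
    (↭-reflexive (sym (cong₂ _++_ (replicate-+ a a' e) (cong₂ _++_ (replicate-+ b b' g) (replicate-+ c c' h)))))
    where
    replicate-+ : ∀ r s x → replicate (r + s) x ≡ replicate r x ++ replicate s x
    replicate-+ zero    s x = refl
    replicate-+ (suc r) s x = cong (x ∷_) (replicate-+ r s x)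
    interleave : ∀ (A B C A' B' C' : List ℕ) →
      (A ++ B ++ C) ++ (A' ++ B' ++ C') ↭ (A ++ A') ++ (B ++ B') ++ (C ++ C')
    interleave A B C A' B' C' =
      ↭-trans (↭.++-assoc A (B ++ C) (A' ++ B' ++ C'))
      (↭-trans (↭.++⁺ˡ A (↭.shifts (B ++ C) A'))
      (↭-trans (↭-sym (↭.++-assoc A A' ((B ++ C) ++ (B' ++ C'))))
      (↭.++⁺ˡ (A ++ A')
        (↭-trans (↭.++-assoc B C (B' ++ C'))
        (↭-trans (↭.++⁺ˡ B (↭.shifts C B'))
        (↭-sym (↭.++-assoc B B' (C ++ C'))))))))

  concat-seq : ∀ vs → concat (map seq vs) ↭ seq (sumₘ vs)
  concat-seq []       = ↭-refl
  concat-seq (v ∷ vs) = ↭-trans (↭.++⁺ˡ (seq v) (concat-seq vs)) (seq-⊕ v (sumₘ vs))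

-- With all of c₁, c₂, d, q₁, q₂, t positive
-- (the primed parameters are one less), (c₁, c₂, d) ∈ M(n) has quotients
-- q₁ = (n-c₁-c₂)/(c₁c₂) and q₂ = (n-c₁-c₂)d/(c₂n), d = n/t, and e is a
-- generator of ℤ/nℤ.
module Setting (n c₁' c₂' d' q₁' q₂' t' e : ℕ) .{{_ : NonZero n}}
  (n≡c₁+c₂+q₁c₁c₂ : n ≡ suc c₁' + suc c₂' + suc q₁' * suc c₁' * suc c₂')
  (n≡td : n ≡ suc t' * suc d')
  (q₂n≡q₁c₁d : suc q₂' * n ≡ suc q₁' * suc c₁' * suc d')
  (e<n : e < n) (gcd[e,n]≡1 : gcd e n ≡ 1) where

  c₁ c₂ d q₁ q₂ t : ℕ
  c₁ = suc c₁'
  c₂ = suc c₂'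
  d  = suc d'
  q₁ = suc q₁'
  q₂ = suc q₂'
  t  = suc t'

  -- g = ke with k = (n - c₁)/c₂; k' is an inverse of k modulo n.
  k k' : ℕ
  k  = suc (q₁ * c₁)
  k' = suc (q₁ * c₂)

  m : ℕ
  m = gcd q₁ q₂

  n≡c₁+c₂k : n ≡ c₁ + c₂ * k
  n≡c₁+c₂k = trans n≡c₁+c₂+q₁c₁c₂ (expand c₁ c₂ q₁)
    where
    expand : ∀ c₁ c₂ q₁ → c₁ + c₂ + q₁ * c₁ * c₂ ≡ c₁ + c₂ * (1 + q₁ * c₁)
    expand = solve-∀

  n≡c₂+c₁k' : n ≡ c₂ + c₁ * k'
  n≡c₂+c₁k' = trans n≡c₁+c₂+q₁c₁c₂ (expand c₁ c₂ q₁)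
    where
    expand : ∀ c₁ c₂ q₁ → c₁ + c₂ + q₁ * c₁ * c₂ ≡ c₂ + c₁ * (1 + q₁ * c₂)
    expand = solve-∀

  kk'≡1+q₁n : k * k' ≡ 1 + q₁ * n
  kk'≡1+q₁n = trans (expand c₁ c₂ q₁) (cong (λ x → 1 + q₁ * x) (sym n≡c₁+c₂+q₁c₁c₂))
    where
    expand : ∀ c₁ c₂ q₁ → (1 + q₁ * c₁) * (1 + q₁ * c₂) ≡ 1 + q₁ * (c₁ + c₂ + q₁ * c₁ * c₂)
    expand = solve-∀

  kd≡d+q₂n : k * d ≡ d + q₂ * n
  kd≡d+q₂n = trans (*-distribʳ-+ d 1 (q₁ * c₁)) (cong₂ _+_ (+-identityʳ d) (sym q₂n≡q₁c₁d))

  -- Size estimates: q₂c₂ < d (as dn = d(c₁ + c₂) + q₂c₂n), so 2 ≤ d;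
  -- d ≤ n, k ≤ n, and dc < n for c < t.
  q₂c₂<d : q₂ * c₂ < d
  q₂c₂<d = *-cancelʳ-< n (q₂ * c₂) d (begin-strict
    q₂ * c₂ * n                 <⟨ m<n+m (q₂ * c₂ * n) {d * (c₁ + c₂)} z<s ⟩
    d * (c₁ + c₂) + q₂ * c₂ * n ≡⟨ dn ⟨
    d * n                       ∎)
    where
    open ≤-Reasoning
    rearrange : ∀ d c₁ c₂ q₁ q₂n → q₂n ≡ q₁ * c₁ * d →
                d * (c₁ + c₂ + q₁ * c₁ * c₂) ≡ d * (c₁ + c₂) + c₂ * q₂n
    rearrange d c₁ c₂ q₁ q₂n refl = distribute d c₁ c₂ q₁
      where
      distribute : ∀ d c₁ c₂ q₁ → d * (c₁ + c₂ + q₁ * c₁ * c₂) ≡ d * (c₁ + c₂) + c₂ * (q₁ * c₁ * d)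
      distribute = solve-∀
    dn : d * n ≡ d * (c₁ + c₂) + q₂ * c₂ * n
    dn = trans (cong (d *_) n≡c₁+c₂+q₁c₁c₂)
         (trans (rearrange d c₁ c₂ q₁ (q₂ * n) q₂n≡q₁c₁d)
         (cong (d * (c₁ + c₂) +_) (trans (sym (*-assoc c₂ q₂ n)) (cong (_* n) (*-comm c₂ q₂)))))

  2≤d : 2 ≤ d
  2≤d = ≤-<-trans {1} {q₂ * c₂} (s≤s z≤n) q₂c₂<d

  d≤n : d ≤ n
  d≤n = subst (d ≤_) (sym n≡td) (m≤m+n d (t' * d))

  dc<n : ∀ {c} → c < t → d * c < n
  dc<n c<t = subst (_ <_) (trans (*-comm d t) (sym n≡td)) (*-monoʳ-< d c<t)

  k≤n : k ≤ n
  k≤n = subst (k ≤_) (sym n≡c₁+c₂k) (≤-trans (m≤n*m k c₂) (m≤n+m (c₂ * k) c₁))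


  g h : ℕ
  g = (k * e) % n
  h = (d * e) % n

  coprime[n,e] : Coprime n e
  coprime[n,e] = Coprime.sym (gcd≡1⇒coprime {e} gcd[e,n]≡1)

  coprime[k,n] : Coprime k n
  coprime[k,n] {i} (i∣k , i∣n) = ∣1⇒≡1 (∣m+n∣m⇒∣n i∣q₁n+1 (∣n⇒∣m*n q₁ i∣n))
    where
    i∣q₁n+1 : i ∣ q₁ * n + 1
    i∣q₁n+1 = subst (i ∣_) (trans kk'≡1+q₁n (+-comm 1 (q₁ * n))) (∣m⇒∣m*n k' i∣k)

  ·e-injective : ∀ x y → x ≤ y → (x * e) % n ≡ (y * e) % n → n ∣ y ∸ x
  ·e-injective x y x≤y same = coprime-divisor coprime[n,e] (subst (n ∣_) (*-comm (y ∸ x) e)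
    (%-shift⇒∣ n (x * e) ((y ∸ x) * e) (trans same (cong (_% n) (sym y*e≡)))))
    where
    y*e≡ : (y ∸ x) * e + x * e ≡ y * e
    y*e≡ = trans (sym (*-distribʳ-+ e (y ∸ x) x)) (cong (_* e) (m∸n+n≡m x≤y))

  e≡1·e : e ≡ (1 * e) % n
  e≡1·e = sym (trans (cong (_% n) (*-identityˡ e)) (m<n⇒m%n≡m e<n))

  e≢g : e ≢ g
  e≢g e≡g = ∤-between {n} {q₁ * c₁} z<s k≤n (·e-injective 1 k (s≤s z≤n) (trans (sym e≡1·e) e≡g))

  e≢h : e ≢ h
  e≢h e≡h = ∤-between {n} {d'} (s≤s⁻¹ 2≤d) d≤n (·e-injective 1 d (s≤s z≤n) (trans (sym e≡1·e) e≡h))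

  g≢h : g ≢ h
  g≢h g≡h with <-cmp k d
  ... | tri< k<d _ _ = ∤-between (m<n⇒0<n∸m k<d) (<-≤-trans (∸-monoʳ-< z<s (<⇒≤ k<d)) d≤n)
                         (·e-injective k d (<⇒≤ k<d) g≡h)
  ... | tri> _ _ d<k = ∤-between (m<n⇒0<n∸m d<k) (<-≤-trans (∸-monoʳ-< z<s (<⇒≤ d<k)) k≤n)
                         (·e-injective d k (<⇒≤ d<k) (sym g≡h))
  ... | tri≈ _ k≡d _ = <-irrefl (sym (coprime[k,n] (subst (d ∣_) (sym k≡d) ∣-refl , divides t n≡td))) 2≤d

  e-generates : IsGen n e
  e-generates = e<n , gcd[e,n]≡1

  g-generates : IsGen n g
  g-generates = m%n<n (k * e) n , coprime⇒gcd≡1 coprime[g,n]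
    where
    coprime[g,n] : Coprime g n
    coprime[g,n] {i} (i∣g , i∣n) =
      gcd≡1⇒coprime {e} gcd[e,n]≡1 (coprime-divisor coprime[i,k] (∣n∣m%n⇒∣m i∣n i∣g) , i∣n)
      where
      coprime[i,k] : Coprime i k
      coprime[i,k] (j∣i , j∣k) = coprime[k,n] (j∣k , ∣-trans j∣i i∣n)

  -- de does not generate, as the proper divisor d ≥ 2 of n divides it.
  h-does-not-generate : ¬ IsGen n h
  h-does-not-generate (_ , gcd[h,n]≡1) = <-irrefl (sym (∣1⇒≡1 (subst (d ∣_) gcd[h,n]≡1 (gcd-greatest d∣h d∣n)))) 2≤d
    where
    d∣n : d ∣ n
    d∣n = divides t n≡td
    d∣h : d ∣ h
    d∣h = ∣m+n∣m⇒∣n (subst (d ∣_) (trans (m≡m%n+[m/n]*n (d * e) n) (+-comm h _)) (m∣m*n e))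
                    (∣n⇒∣m*n ((d * e) / n) d∣n)

  open ThreeElementSequences e g h e≢g e≢h g≢h

  G₀-subset : IsSubset n G₀
  G₀-subset = e<n ∷ m%n<n (k * e) n ∷ m%n<n (d * e) n ∷ []

  G₀-two-generators : ExactlyTwoGens n G₀
  G₀-two-generators = e , g , e≢g , here refl , there (here refl) , e-generates , g-generates , only-e-g
    where
    only-e-g : ∀ x → x ∈ G₀ → IsGen n x → x ≡ e ⊎ x ≡ g
    only-e-g x (here x≡e) _ = inj₁ x≡e
    only-e-g x (there (here x≡g)) _ = inj₂ x≡g
    only-e-g x (there (there (here refl))) x-gen = ⊥-elim (h-does-not-generate x-gen)

  -- Modulo n a sequence over G₀ with multiplicities (a, b, c) sums to
  -- (a + kb + dc)e; we call a + kb + dc its weight.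
  weight : Mult → ℕ
  weight = lin k d

  weight-⊕ : ∀ u v → weight (u ⊕ v) ≡ weight u + weight v
  weight-⊕ = lin-⊕ k d

  term≡e·weight : ∀ {x} → x ∈ G₀ → Σ ℕ λ r → x + r * n ≡ e * weight (unit x)
  term≡e·weight (here refl) = 0 , (begin
    e + 0 * n            ≡⟨ +-identityʳ e ⟩
    e                    ≡⟨ *-identityʳ e ⟨
    e * 1                ≡⟨ cong (e *_) (trans (cong weight unit-e) (lin-first k d)) ⟨
    e * weight (unit e)  ∎)
    where open ≡-Reasoning
  term≡e·weight (there (here refl)) = (k * e) / n , (begin
    g + (k * e) / n * n  ≡⟨ m≡m%n+[m/n]*n (k * e) n ⟨
    k * e                ≡⟨ *-comm k e ⟩
    e * k                ≡⟨ cong (e *_) (trans (cong weight unit-g) (lin-second k d)) ⟨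
    e * weight (unit g)  ∎)
    where open ≡-Reasoning
  term≡e·weight (there (there (here refl))) = (d * e) / n , (begin
    h + (d * e) / n * n  ≡⟨ m≡m%n+[m/n]*n (d * e) n ⟨
    d * e                ≡⟨ *-comm d e ⟩
    e * d                ≡⟨ cong (e *_) (trans (cong weight unit-h) (lin-third k d)) ⟨
    e * weight (unit h)  ∎)
    where open ≡-Reasoning

  sum≡e·weight : ∀ xs → All (_∈ G₀) xs → Σ ℕ λ R → sum xs + R * n ≡ e * weight (mult xs)
  sum≡e·weight [] [] = 0 , trans (sym (*-zeroʳ e)) (cong (e *_) (sym (lin-𝟘 k d)))
  sum≡e·weight (x ∷ xs) (x∈G₀ ∷ xs⊆G₀) =
    let r , x≡ = term≡e·weight x∈G₀
        R , xs≡ = sum≡e·weight xs xs⊆G₀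
    in r + R , (begin
    x + sum xs + (r + R) * n                   ≡⟨ regroup x (sum xs) r R ⟩
    (x + r * n) + (sum xs + R * n)             ≡⟨ cong₂ _+_ x≡ xs≡ ⟩
    e * weight (unit x) + e * weight (mult xs) ≡⟨ *-distribˡ-+ e (weight (unit x)) (weight (mult xs)) ⟨
    e * (weight (unit x) + weight (mult xs))   ≡⟨ cong (e *_) (weight-⊕ (unit x) (mult xs)) ⟨
    e * weight (unit x ⊕ mult xs)              ∎)
    where
    open ≡-Reasoning
    regroup : ∀ a b u v → a + b + (u + v) * n ≡ (a + u * n) + (b + v * n)
    regroup a b u v = trans (cong (a + b +_) (*-distribʳ-+ n u v)) (+-CS.interchange a b (u * n) (v * n))

  zero-sum⇒n∣weight : ∀ {xs} → All (_∈ G₀) xs → n ∣ sum xs → n ∣ weight (mult xs)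
  zero-sum⇒n∣weight {xs} xs⊆G₀ n∣Σ = let R , eq = sum≡e·weight xs xs⊆G₀ in
    coprime-divisor coprime[n,e] (subst (n ∣_) eq (∣m∣n⇒∣m+n n∣Σ (n∣m*n R)))

  n∣weight⇒zero-sum : ∀ {xs} → All (_∈ G₀) xs → n ∣ weight (mult xs) → n ∣ sum xs
  n∣weight⇒zero-sum {xs} xs⊆G₀ n∣w = let R , eq = sum≡e·weight xs xs⊆G₀ in
    ∣m+n∣m⇒∣n (subst (n ∣_) (trans (sym eq) (+-comm (sum xs) (R * n))) (∣n⇒∣m*n e n∣w)) (n∣m*n R)

  Minimal : Mult → Set
  Minimal v = ∀ u → u ≤ₘ v → 1 ≤ size u → n ∣ weight u → size u ≡ size v

  seq-atom : ∀ v → n ∣ weight v → 1 ≤ size v → Minimal v → IsAtom n G₀ (seq v)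
  seq-atom v n∣w 1≤size minimal =
    (seq-over-G₀ v , n∣weight⇒zero-sum (seq-over-G₀ v) (subst (n ∣_) (cong weight (sym (mult-seq v))) n∣w)) ,
    subst (1 ≤_) (sym (length-seq v)) 1≤size , minimal-seq
    where
    minimal-seq : ∀ T → T ⊆ seq v → NonEmpty T → ZeroSum n T → length T ≡ length (seq v)
    minimal-seq T T⊆ 1≤len zero-sum = begin
      length T        ≡⟨ size-mult T ⟨
      size (mult T)   ≡⟨ minimal (mult T) (subst (mult T ≤ₘ_) (mult-seq v) (mult-⊆ T⊆))
                          (subst (1 ≤_) (sym (size-mult T)) 1≤len)
                          (zero-sum⇒n∣weight (All-resp-⊆ T⊆ (seq-over-G₀ v)) zero-sum) ⟩
      size v          ≡⟨ length-seq v ⟨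
      length (seq v)  ∎
      where open ≡-Reasoning

  atom-minimal : ∀ {A} → IsAtom n G₀ A → Minimal (mult A)
  atom-minimal {A} ((A⊆G₀ , _) , _ , minimal) u u≤ 1≤size n∣w =
    let T , T⊆ , T↦u = extract A u u≤ in begin
    size u          ≡⟨ cong size T↦u ⟨
    size (mult T)   ≡⟨ size-mult T ⟩
    length T        ≡⟨ minimal T T⊆ (subst (1 ≤_) (trans (sym (cong size T↦u)) (size-mult T)) 1≤size)
                         (n∣weight⇒zero-sum (All-resp-⊆ T⊆ A⊆G₀) (subst (n ∣_) (cong weight (sym T↦u)) n∣w)) ⟩
    length A        ≡⟨ size-mult A ⟨
    size (mult A)   ∎
    where open ≡-Reasoning

  k[y+dc]≡ : ∀ y c → k * (y + d * c) ≡ (k * y + d * c) + q₂ * c * n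
  k[y+dc]≡ y c = begin
    k * (y + d * c)           ≡⟨ distribute k y d c ⟩
    k * y + (k * d) * c       ≡⟨ cong (λ x → k * y + x * c) kd≡d+q₂n ⟩
    k * y + (d + q₂ * n) * c  ≡⟨ rearrange (k * y) d (q₂ * n) c ⟩
    (k * y + d * c) + q₂ * n * c ≡⟨ cong ((k * y + d * c) +_) (*-comm-middle q₂ n c) ⟩
    (k * y + d * c) + q₂ * c * n ∎
    where
    open ≡-Reasoning
    distribute : ∀ k y d c → k * (y + d * c) ≡ k * y + (k * d) * c
    distribute = solve-∀
    rearrange : ∀ a b x c → a + (b + x) * c ≡ (a + b * c) + x * c
    rearrange = solve-∀
    *-comm-middle : ∀ a b c → a * b * c ≡ a * c * b
    *-comm-middle = solve-∀

  -- The key arithmetic fact: if n ∣ a + kB with a < c₁, B ≤ n and a + B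
  -- positive, then B + k'a = n (multiply by the inverse k' of k and
  -- compare sizes).
  key-lemma : ∀ a B → a < c₁ → B ≤ n → 1 ≤ a + B → n ∣ a + k * B → B + k' * a ≡ n
  key-lemma a B a<c₁ B≤n 1≤a+B n∣a+kB =
    multiple-below-double n∣B+k'a 0<B+k'a (+-mono-≤-< B≤n k'a<n)
    where
    k'[a+kB]≡ : k' * (a + k * B) ≡ q₁ * B * n + (B + k' * a)
    k'[a+kB]≡ = begin
      k' * (a + k * B)         ≡⟨ distribute k' a k B ⟩
      k' * a + (k * k') * B    ≡⟨ cong (λ x → k' * a + x * B) kk'≡1+q₁n ⟩
      k' * a + (1 + q₁ * n) * B ≡⟨ rearrange k' a q₁ n B ⟩
      q₁ * B * n + (B + k' * a) ∎
      where
      open ≡-Reasoning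
      distribute : ∀ k' a k B → k' * (a + k * B) ≡ k' * a + (k * k') * B
      distribute = solve-∀
      rearrange : ∀ k' a q₁ n B → k' * a + (1 + q₁ * n) * B ≡ q₁ * B * n + (B + k' * a)
      rearrange = solve-∀
    n∣B+k'a : n ∣ B + k' * a
    n∣B+k'a = ∣m+n∣m⇒∣n (subst (n ∣_) k'[a+kB]≡ (∣n⇒∣m*n k' n∣a+kB)) (n∣m*n (q₁ * B))
    0<B+k'a : 0 < B + k' * a
    0<B+k'a = subst (1 ≤_) (+-comm (k' * a) B) (≤-trans 1≤a+B (+-monoˡ-≤ B (m≤n*m a k')))
    k'a<n : k' * a < n
    k'a<n = begin-strict
      k' * a        <⟨ *-monoʳ-< k' a<c₁ ⟩
      k' * c₁       ≡⟨ *-comm k' c₁ ⟩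
      c₁ * k'       ≤⟨ m≤n+m (c₁ * k') c₂ ⟩
      c₂ + c₁ * k'  ≡⟨ n≡c₂+c₁k' ⟨
      n             ∎
      where open ≤-Reasoning

  key-lemma′ : ∀ a B → a < c₁ → B ≤ n → 1 ≤ a + B → n ∣ a + k * B → a + k * B ≡ n * (1 + q₁ * (c₁ ∸ a))
  key-lemma′ a B a<c₁ B≤n 1≤a+B n∣a+kB = +-cancelʳ-≡ (q₁ * n * a) (a + k * B) (n * (1 + q₁ * j)) (begin
    (a + k * B) + q₁ * n * a      ≡⟨ rearrange a k B q₁ n ⟩
    k * B + (1 + q₁ * n) * a      ≡⟨ cong (λ x → k * B + x * a) kk'≡1+q₁n ⟨
    k * B + (k * k') * a          ≡⟨ factor k B k' a ⟩
    k * (B + k' * a)              ≡⟨ cong (k *_) (key-lemma a B a<c₁ B≤n 1≤a+B n∣a+kB) ⟩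
    k * n                         ≡⟨ cong (λ x → (1 + q₁ * x) * n) a+j≡c₁ ⟨
    (1 + q₁ * (a + j)) * n        ≡⟨ expand n q₁ j a ⟨
    n * (1 + q₁ * j) + q₁ * n * a ∎)
    where
    open ≡-Reasoning
    j = c₁ ∸ a
    a+j≡c₁ : a + j ≡ c₁
    a+j≡c₁ = m+[n∸m]≡n (<⇒≤ a<c₁)
    rearrange : ∀ a k B q₁ n → (a + k * B) + q₁ * n * a ≡ k * B + (1 + q₁ * n) * a
    rearrange = solve-∀
    factor : ∀ k B k' a → k * B + (k * k') * a ≡ k * (B + k' * a)
    factor = solve-∀
    expand : ∀ n q₁ j a → n * (1 + q₁ * j) + q₁ * n * a ≡ (1 + q₁ * (a + j)) * n
    expand = solve-∀

  -- The lower bound rests on: every atom has weight sn with s ≡ 1 (mod m).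
  GoodWeight : Mult → Set
  GoodWeight v = Σ ℕ λ s → weight v ≡ s * n × (s ≡ 1 [mod m ])

  weight-n-good : ∀ {v} → weight v ≡ n → GoodWeight v
  weight-n-good w≡n = 1 , trans w≡n (sym (*-identityˡ n)) , 0 , 0 , refl

  dominates-weight-n : ∀ {u v} → u ≤ₘ v → 1 ≤ size u → weight u ≡ n → Minimal v → GoodWeight v
  dominates-weight-n {u} {v} u≤v 1≤size wu≡n minimal = weight-n-good {v} (trans (cong weight (sym u≡v)) wu≡n)
    where
    u≡v : u ≡ v
    u≡v = ≤ₘ-size-injective u≤v (minimal u u≤v 1≤size (subst (n ∣_) (sym wu≡n) ∣-refl))

  -- Case c ≥ t: the atom dominates h^t, of weight dt = n.
  good-if-t≤c : ∀ a b c → t ≤ c → Minimal (a , b , c) → GoodWeight (a , b , c)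
  good-if-t≤c a b c t≤c = dominates-weight-n (z≤n , z≤n , t≤c) (s≤s z≤n) (trans (weigh k d t) (sym n≡td))
    where
    weigh : ∀ k d t → 0 + k * 0 + d * t ≡ t * d
    weigh = solve-∀

  -- Case c < t, n ≤ a + dc: the atom dominates e^(n-dc) h^c, of weight n.
  good-if-n≤a+dc : ∀ a b c → c < t → n ≤ a + d * c → Minimal (a , b , c) → GoodWeight (a , b , c)
  good-if-n≤a+dc a b c c<t n≤a+dc = dominates-weight-n
    (x≤a , z≤n , ≤-refl) (≤-trans (m<n⇒0<n∸m (dc<n c<t)) (≤-trans (m≤m+n x 0) (m≤m+n (x + 0) c)))
    (trans (weigh x k d c) x+dc≡n)
    where
    x = n ∸ d * c
    x+dc≡n : x + d * c ≡ n
    x+dc≡n = m∸n+n≡m (<⇒≤ (dc<n c<t))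
    x≤a : x ≤ a
    x≤a = +-cancelʳ-≤ (d * c) x a (subst (_≤ a + d * c) (sym x+dc≡n) n≤a+dc)
    weigh : ∀ x k d c → x + k * 0 + d * c ≡ x + d * c
    weigh = solve-∀

  -- Case a ≥ c₁, b ≥ c₂: the atom dominates e^c₁ g^c₂, of weight n.
  good-if-c₁≤a-c₂≤b : ∀ a b c → c₁ ≤ a → c₂ ≤ b → Minimal (a , b , c) → GoodWeight (a , b , c)
  good-if-c₁≤a-c₂≤b a b c c₁≤a c₂≤b = dominates-weight-n (c₁≤a , c₂≤b , z≤n) (s≤s z≤n)
    (trans (weigh c₁ k c₂ d) (sym n≡c₁+c₂k))
    where
    weigh : ∀ c₁ k c₂ d → c₁ + k * c₂ + d * 0 ≡ c₁ + c₂ * k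
    weigh = solve-∀

  -- Case a ≥ c₁, b < c₂, a + dc < n: then the weight is below 2n, so it is n.
  good-if-small : ∀ a b c → c₁ ≤ a → b < c₂ → a + d * c < n → n ∣ weight (a , b , c) → GoodWeight (a , b , c)
  good-if-small a b c c₁≤a b<c₂ a+dc<n n∣w = weight-n-good {a , b , c} (multiple-below-double n∣w 0<w w<2n)
    where
    0<w : 0 < weight (a , b , c)
    0<w = ≤-trans (≤-trans (s≤s z≤n) c₁≤a) (≤-trans (m≤m+n a (k * b)) (m≤m+n (a + k * b) (d * c)))
    kb≤n : k * b ≤ n
    kb≤n = begin
      k * b         ≤⟨ *-monoʳ-≤ k (<⇒≤ b<c₂) ⟩
      k * c₂        ≡⟨ *-comm k c₂ ⟩
      c₂ * k        ≤⟨ m≤n+m (c₂ * k) c₁ ⟩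
      c₁ + c₂ * k   ≡⟨ n≡c₁+c₂k ⟨
      n             ∎
      where open ≤-Reasoning
    w<2n : weight (a , b , c) < n + n
    w<2n = subst (_< n + n) (sym (swap-middle a (k * b) (d * c))) (+-mono-<-≤ a+dc<n kb≤n)
      where
      swap-middle : ∀ x y z → x + y + z ≡ x + z + y
      swap-middle x y z = +-CS.xy∙z≈xz∙y x y z

  -- Case a < c₁, c < t: by the key lemma applied to B = b + dc (which
  -- cannot exceed n by minimality), a + kB = n(1 + q₁(c₁-a)), while
  -- a + kB = weight + q₂cn; so s + q₂c = 1 + q₁(c₁-a) and s ≡ 1 (mod m).
  good-if-a<c₁-c<t : ∀ a b c → a < c₁ → c < t → n ∣ weight (a , b , c) → 1 ≤ size (a , b , c) →
    Minimal (a , b , c) → GoodWeight (a , b , c)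
  good-if-a<c₁-c<t a b c a<c₁ c<t n∣w 1≤size minimal with n <? b + d * c
  ... | yes n<B = ⊥-elim (<-irrefl (minimal (0 , y , c) (z≤n , <⇒≤ y<b , ≤-refl) 1≤y+c n∣weight[y,c]) y+c<size)
    where
    y = n ∸ d * c
    y+dc≡n : y + d * c ≡ n
    y+dc≡n = m∸n+n≡m (<⇒≤ (dc<n c<t))
    y<b : y < b
    y<b = +-cancelʳ-< (d * c) y b (subst (_< b + d * c) (sym y+dc≡n) n<B)
    1≤y+c : 1 ≤ 0 + y + c
    1≤y+c = ≤-trans (m<n⇒0<n∸m (dc<n c<t)) (m≤m+n y c)
    n∣weight[y,c] : n ∣ weight (0 , y , c)
    n∣weight[y,c] = ∣m+n∣m⇒∣n
      (subst (n ∣_) (trans (cong (k *_) (sym y+dc≡n)) (trans (k[y+dc]≡ y c) (+-comm (k * y + d * c) (q₂ * c * n))))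
        (n∣m*n k))
      (n∣m*n (q₂ * c))
    y+c<size : 0 + y + c < a + b + c
    y+c<size = +-monoˡ-< c (<-≤-trans y<b (m≤n+m b a))
  ... | no n≮B with n∣w
  ...   | divides s w≡sn =
    s , w≡sn , ≡-mod-intro s+q₂c≡1+q₁j (∣m⇒∣m*n c (gcd[m,n]∣n q₁ q₂)) (∣m⇒∣m*n j (gcd[m,n]∣m q₁ q₂))
    where
    open ≡-Reasoning
    B = b + d * c
    j = c₁ ∸ a
    a+kB≡ : a + k * B ≡ weight (a , b , c) + q₂ * c * n
    a+kB≡ = begin
      a + k * B                           ≡⟨ cong (a +_) (k[y+dc]≡ b c) ⟩
      a + ((k * b + d * c) + q₂ * c * n)  ≡⟨ regroup a (k * b) (d * c) (q₂ * c * n) ⟩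
      weight (a , b , c) + q₂ * c * n     ∎
      where
      regroup : ∀ w x y z → w + ((x + y) + z) ≡ (w + x + y) + z
      regroup = solve-∀
    n∣a+kB : n ∣ a + k * B
    n∣a+kB = subst (n ∣_) (sym a+kB≡) (∣m∣n⇒∣m+n n∣w (n∣m*n (q₂ * c)))
    1≤a+B : 1 ≤ a + B
    1≤a+B = ≤-trans 1≤size (subst (a + b + c ≤_) (+-assoc a b (d * c)) (+-monoʳ-≤ (a + b) (m≤n*m c d)))
    s+q₂c≡1+q₁j : s + q₂ * c ≡ 1 + q₁ * j
    s+q₂c≡1+q₁j = *-cancelʳ-≡ (s + q₂ * c) (1 + q₁ * j) n (begin
      (s + q₂ * c) * n            ≡⟨ *-distribʳ-+ n s (q₂ * c) ⟩
      s * n + q₂ * c * n          ≡⟨ cong (_+ q₂ * c * n) w≡sn ⟨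
      weight (a , b , c) + q₂ * c * n ≡⟨ a+kB≡ ⟨
      a + k * B                   ≡⟨ key-lemma′ a B a<c₁ (≮⇒≥ n≮B) 1≤a+B n∣a+kB ⟩
      n * (1 + q₁ * j)            ≡⟨ *-comm n (1 + q₁ * j) ⟩
      (1 + q₁ * j) * n            ∎)

  atom-good-weight : ∀ v → n ∣ weight v → 1 ≤ size v → Minimal v → GoodWeight v
  atom-good-weight (a , b , c) n∣w 1≤size minimal with t ≤? c | n ≤? a + d * c | c₁ ≤? a | c₂ ≤? b
  ... | yes t≤c | _ | _ | _ = good-if-t≤c a b c t≤c minimal
  ... | no t≰c | yes n≤a+dc | _ | _ = good-if-n≤a+dc a b c (≰⇒> t≰c) n≤a+dc minimal
  ... | no _ | no _ | yes c₁≤a | yes c₂≤b = good-if-c₁≤a-c₂≤b a b c c₁≤a c₂≤b minimal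
  ... | no _ | no n≰a+dc | yes c₁≤a | no c₂≰b = good-if-small a b c c₁≤a (≰⇒> c₂≰b) (≰⇒> n≰a+dc) n∣w
  ... | no t≰c | no _ | no c₁≰a | _ = good-if-a<c₁-c<t a b c (≰⇒> c₁≰a) (≰⇒> t≰c) n∣w 1≤size minimal

  concat-weight : ∀ fs → All (IsAtom n G₀) fs → Σ ℕ λ S → weight (mult (concat fs)) ≡ S * n × (S ≡ length fs [mod m ])
  concat-weight [] [] = 0 , lin-𝟘 k d , 0 , 0 , refl
  concat-weight (A ∷ fs) (A-atom@((A⊆G₀ , zero-sum) , 1≤len , _) ∷ atoms) =
    let s , wA≡sn , s≡1 = atom-good-weight (mult A) (zero-sum⇒n∣weight A⊆G₀ zero-sum)
                            (subst (1 ≤_) (sym (size-mult A)) 1≤len) (atom-minimal A-atom)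
        S , w≡Sn , S≡ℓ = concat-weight fs atoms
    in s + S , (begin
    weight (mult (A ++ concat fs))              ≡⟨ cong weight (mult-++ A (concat fs)) ⟩
    weight (mult A ⊕ mult (concat fs))          ≡⟨ weight-⊕ (mult A) (mult (concat fs)) ⟩
    weight (mult A) + weight (mult (concat fs)) ≡⟨ cong₂ _+_ wA≡sn w≡Sn ⟩
    s * n + S * n                               ≡⟨ *-distribʳ-+ n s S ⟨
    (s + S) * n                                 ∎) , ≡-mod-+ s≡1 S≡ℓ
    where open ≡-Reasoning

  factorization-weight : ∀ {B ℓ} → InL n G₀ B ℓ → Σ ℕ λ S → weight (mult B) ≡ S * n × (S ≡ ℓ [mod m ])
  factorization-weight (fs , atoms , fs↭B , refl) = let S , w≡Sn , S≡ℓ = concat-weight fs atoms in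
    S , trans (cong weight (sym (mult-↭ fs↭B))) w≡Sn , S≡ℓ

  lengths-congruent : ∀ {B ℓ ℓ'} → InL n G₀ B ℓ → InL n G₀ B ℓ' → ℓ ≡ ℓ' [mod m ]
  lengths-congruent L L' =
    let S , w≡Sn , S≡ℓ = factorization-weight L
        S' , w≡S'n , S'≡ℓ' = factorization-weight L'
    in
    ≡-mod-trans (≡-mod-sym S≡ℓ) (subst (_≡ _ [mod m ]) (*-cancelʳ-≡ S' S n (trans (sym w≡S'n) w≡Sn)) S'≡ℓ')

  m≤Δ : ∀ δ → InΔG n G₀ δ → m ≤ δ
  m≤Δ δ (B , _ , ℓ , L , L' , 1≤δ , _) = ∣⇒≤ {{>-nonZero 1≤δ}} (≡-mod-shift⇒∣ (lengths-congruent L L'))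

  no-length-between : ∀ {B ℓ} → InL n G₀ B ℓ → ∀ ℓ' → ℓ < ℓ' → ℓ' < ℓ + m → ¬ InL n G₀ B ℓ'
  no-length-between {B} {ℓ} L ℓ' ℓ<ℓ' ℓ'<ℓ+m L' =
    ∤-between (m<n⇒0<n∸m ℓ<ℓ') (+-cancelˡ-< ℓ (ℓ' ∸ ℓ) m (subst (_< ℓ + m) (sym ℓ+δ≡ℓ') ℓ'<ℓ+m))
      (≡-mod-shift⇒∣ (subst (ℓ ≡_[mod m ]) (sym ℓ+δ≡ℓ') (lengths-congruent L L')))
    where
    ℓ+δ≡ℓ' : ℓ + (ℓ' ∸ ℓ) ≡ ℓ'
    ℓ+δ≡ℓ' = m+[n∸m]≡n (<⇒≤ ℓ<ℓ')

  -- A nonempty vector of weight exactly n is an atom: a nonempty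
  -- sub-vector of weight divisible by n has weight n, hence is everything.
  weight-n-atom : ∀ v → weight v ≡ n → 1 ≤ size v → IsAtom n G₀ (seq v)
  weight-n-atom v w≡n 1≤size = seq-atom v (subst (n ∣_) (sym w≡n) ∣-refl) 1≤size minimal
    where
    minimal : Minimal v
    minimal u u≤v 1≤size-u n∣wu = cong size (≤ₘ-lin-injective k d u≤v (trans wu≡n (sym w≡n)))
      where
      wu≡n : weight u ≡ n
      wu≡n = multiple-at-most n∣wu (≤-trans 1≤size-u (size≤lin k d u)) (subst (weight u ≤_) w≡n (lin-mono k d u≤v))

  -- The atoms used in the two trades below (j + ρ = c₂):
  --   U = e^c₁ g^c₂,  G j ρ = e^(c₁+kρ) g^j,  E = G 0 c₂ = e^n,  H = e^d h^(t-1),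
  -- all of weight n, and V = e^(c₁-1) g^(c₂+k') of weight (1+q₁)n and
  -- W = g^d h^(t-1) of weight (1+q₂)n.
  G : ℕ → ℕ → Mult
  G j ρ = c₁ + k * ρ , j , 0

  U E H V W : Mult
  U = c₁ , c₂ , 0
  E = G 0 c₂
  H = d , 0 , t'
  V = c₁' , c₂ + k' , 0
  W = 0 , d , t'

  U-atom : IsAtom n G₀ (seq U)
  U-atom = weight-n-atom U (trans (weigh c₁ k c₂ d) (sym n≡c₁+c₂k)) (s≤s z≤n)
    where
    weigh : ∀ c₁ k c₂ d → c₁ + k * c₂ + d * 0 ≡ c₁ + c₂ * k
    weigh = solve-∀

  G-atom : ∀ j ρ → j + ρ ≡ c₂ → IsAtom n G₀ (seq (G j ρ))
  G-atom j ρ j+ρ≡c₂ = weight-n-atom (G j ρ) w≡n (s≤s z≤n)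
    where
    weigh : ∀ c₁ k ρ j d → c₁ + k * ρ + k * j + d * 0 ≡ c₁ + (j + ρ) * k
    weigh = solve-∀
    w≡n : weight (G j ρ) ≡ n
    w≡n = trans (weigh c₁ k ρ j d) (trans (cong (λ x → c₁ + x * k) j+ρ≡c₂) (sym n≡c₁+c₂k))

  E-atom : IsAtom n G₀ (seq E)
  E-atom = G-atom 0 c₂ refl

  H-atom : IsAtom n G₀ (seq H)
  H-atom = weight-n-atom H (trans (weigh d k t') (sym n≡td)) (s≤s z≤n)
    where
    weigh : ∀ d k t' → d + k * 0 + d * t' ≡ (1 + t') * d
    weigh = solve-∀

  -- V is minimal by the key lemma: a sub-vector e^x g^y with n ∣ x + ky
  -- has y + k'x = n = (c₂ + k') + k'(c₁ - 1).
  V-atom : IsAtom n G₀ (seq V)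
  V-atom = seq-atom V (divides (suc q₁) w≡) (≤-trans (s≤s z≤n) (≤-trans (m≤n+m (c₂ + k') c₁') (m≤m+n _ 0))) minimal
    where
    w≡ : weight V ≡ suc q₁ * n
    w≡ = begin
      c₁' + k * (c₂ + k') + d * 0     ≡⟨ expand c₁' k c₂ k' d ⟩
      c₁' + k * c₂ + k * k'           ≡⟨ cong (c₁' + k * c₂ +_) kk'≡1+q₁n ⟩
      c₁' + k * c₂ + (1 + q₁ * n)     ≡⟨ regroup c₁' k c₂ q₁ n ⟩
      (1 + c₁' + c₂ * k) + q₁ * n     ≡⟨ cong (_+ q₁ * n) n≡c₁+c₂k ⟨
      n + q₁ * n                      ∎
      where
      open ≡-Reasoning
      expand : ∀ c₁' k c₂ k' d → c₁' + k * (c₂ + k') + d * 0 ≡ c₁' + k * c₂ + k * k'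
      expand = solve-∀
      regroup : ∀ c₁' k c₂ q₁ n → c₁' + k * c₂ + (1 + q₁ * n) ≡ (1 + c₁' + c₂ * k) + q₁ * n
      regroup = solve-∀
    c₂+k'≤n : c₂ + k' ≤ n
    c₂+k'≤n = subst (c₂ + k' ≤_) (sym n≡c₂+c₁k') (+-monoʳ-≤ c₂ (m≤m+n k' (c₁' * k')))
    minimal : Minimal V
    minimal (x , y , zero) (x≤ , y≤ , _) 1≤size n∣w = cong (λ { (y , x , _) → x + y + 0 }) same
      where
      y+k'x≡n : y + k' * x ≡ n
      y+k'x≡n = key-lemma x y (s≤s x≤) (≤-trans y≤ c₂+k'≤n) (subst (1 ≤_) (+-identityʳ (x + y)) 1≤size)
                  (subst (n ∣_) (drop-third x k y d) n∣w)
        where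
        drop-third : ∀ x k y d → x + k * y + d * 0 ≡ x + k * y
        drop-third = solve-∀
      n≡ : n ≡ (c₂ + k') + k' * c₁'
      n≡ = trans n≡c₂+c₁k' (regroup c₂ c₁' k')
        where
        regroup : ∀ c₂ c₁' k' → c₂ + (1 + c₁') * k' ≡ (c₂ + k') + k' * c₁'
        regroup = solve-∀
      same : (y , x , 0) ≡ (c₂ + k' , c₁' , 0)
      same = ≤ₘ-lin-injective k' 1 (y≤ , x≤ , z≤n) (cong (_+ 1 * 0) (trans y+k'x≡n n≡))

  -- W is minimal: for a sub-vector g^y h^z with n ∣ ky + dz we get
  -- n ∣ k(y + dz), hence n ∣ y + dz ≤ d + dt' = n, so y + dz = n.
  W-atom : IsAtom n G₀ (seq W)
  W-atom = seq-atom W (divides (suc q₂) w≡) (≤-trans (s≤s z≤n) (m≤m+n d t')) minimal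
    where
    n≡d+dt' : n ≡ d + d * t'
    n≡d+dt' = trans n≡td (expand t' d)
      where
      expand : ∀ t' d → (1 + t') * d ≡ d + d * t'
      expand = solve-∀
    w≡ : weight W ≡ suc q₂ * n
    w≡ = begin
      0 + k * d + d * t'        ≡⟨ cong (_+ d * t') kd≡d+q₂n ⟩
      d + q₂ * n + d * t'       ≡⟨ +-CS.xy∙z≈xz∙y d (q₂ * n) (d * t') ⟩
      d + d * t' + q₂ * n       ≡⟨ cong (_+ q₂ * n) n≡d+dt' ⟨
      n + q₂ * n                ∎
      where open ≡-Reasoning
    minimal : Minimal W
    minimal (zero , y , z) (_ , y≤ , z≤) 1≤size n∣w = cong (λ { (_ , y , z) → 0 + y + z }) same
      where
      n∣k[y+dz] : n ∣ k * (y + d * z)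
      n∣k[y+dz] = subst (n ∣_) (sym (k[y+dc]≡ y z)) (∣m∣n⇒∣m+n n∣w (n∣m*n (q₂ * z)))
      y+dz≡n : y + d * z ≡ n
      y+dz≡n = multiple-at-most (coprime-divisor (Coprime.sym coprime[k,n]) n∣k[y+dz])
        (≤-trans 1≤size (+-monoʳ-≤ y (m≤n*m z d)))
        (subst (y + d * z ≤_) (sym n≡d+dt') (+-mono-≤ y≤ (*-monoʳ-≤ d z≤)))
      same : (0 , y , z) ≡ (0 , d , t')
      same = ≤ₘ-lin-injective 1 d (z≤n , y≤ , z≤)
        (trans (cong (_+ d * z) (*-identityˡ y))
          (trans y+dz≡n (trans n≡d+dt' (cong (_+ d * t') (sym (*-identityˡ d))))))

  Atoms : List Mult → Set
  Atoms = All (λ v → IsAtom n G₀ (seq v))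

  factorization : ∀ vs → Atoms vs → InL n G₀ (seq (sumₘ vs)) (length vs)
  factorization vs atoms = map seq vs , All.map⁺ atoms , concat-seq vs , List.length-map seq vs

  Trade : ℕ → Set
  Trade δ = Σ (List Mult) λ vs → Σ (List Mult) λ ws →
    Atoms vs × Atoms ws × sumₘ vs ≡ sumₘ ws × length ws ≡ length vs + δ

  trade⇒m∈Δ : Trade m → InΔG n G₀ m
  trade⇒m∈Δ (vs , ws , vs-atoms , ws-atoms , same , len) =
    seq (sumₘ vs) , (seq-over-G₀ (sumₘ vs) , zero-sum) , length vs , L , L' , 1≤m , no-length-between L
    where
    L : InL n G₀ (seq (sumₘ vs)) (length vs)
    L = factorization vs vs-atoms
    L' : InL n G₀ (seq (sumₘ vs)) (length vs + m)
    L' = subst₂ (InL n G₀) (cong seq (sym same)) len (factorization ws ws-atoms)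
    zero-sum : ZeroSum n (seq (sumₘ vs))
    zero-sum = let S , w≡Sn , _ = factorization-weight L in
      n∣weight⇒zero-sum (seq-over-G₀ (sumₘ vs)) (divides S w≡Sn)
    1≤m : 1 ≤ m
    1≤m = n≢0⇒n>0 (gcd[m,n]≢0 q₁ q₂ (inj₁ λ ()))

  combine : ∀ {a b δ} x y → Trade a → Trade b → x * a ≡ δ + y * b → Trade δ
  combine {a} {b} {δ} x y (vs , ws , vs-at , ws-at , same , len) (vs' , ws' , vs'-at , ws'-at , same' , len') xa≡δ+yb =
    copies x vs ++ copies y ws' , copies x ws ++ copies y vs' ,
    ++⁺ (copies-atoms x vs-at) (copies-atoms y ws'-at) , ++⁺ (copies-atoms x ws-at) (copies-atoms y vs'-at) ,
    sums , lengths
    where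
    open ≡-Reasoning
    copies-atoms : ∀ x {us} → Atoms us → Atoms (copies x us)
    copies-atoms x atoms = concat⁺ (replicate⁺ x atoms)
    sum-mix : ∀ us us' → sumₘ (copies x us ++ copies y us') ≡ x ⊛ sumₘ us ⊕ y ⊛ sumₘ us'
    sum-mix us us' = trans (sumₘ-++ (copies x us) (copies y us')) (cong₂ _⊕_ (sumₘ-copies x us) (sumₘ-copies y us'))
    length-mix : ∀ us us' → length (copies x us ++ copies y us') ≡ x * length us + y * length us'
    length-mix us us' = trans (List.length-++ (copies x us)) (cong₂ _+_ (length-copies x us) (length-copies y us'))
    sums : sumₘ (copies x vs ++ copies y ws') ≡ sumₘ (copies x ws ++ copies y vs')
    sums = begin
      sumₘ (copies x vs ++ copies y ws') ≡⟨ sum-mix vs ws' ⟩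
      x ⊛ sumₘ vs ⊕ y ⊛ sumₘ ws'         ≡⟨ cong₂ (λ u u' → x ⊛ u ⊕ y ⊛ u') same (sym same') ⟩
      x ⊛ sumₘ ws ⊕ y ⊛ sumₘ vs'         ≡⟨ sum-mix ws vs' ⟨
      sumₘ (copies x ws ++ copies y vs') ∎
    lengths : length (copies x ws ++ copies y vs') ≡ length (copies x vs ++ copies y ws') + δ
    lengths = begin
      length (copies x ws ++ copies y vs')   ≡⟨ length-mix ws vs' ⟩
      x * length ws + y * length vs'         ≡⟨ cong (λ l → x * l + y * length vs') len ⟩
      x * (length vs + a) + y * length vs'   ≡⟨ pull-out x y (length vs) a (length vs') ⟩
      (x * length vs + y * length vs') + x * a ≡⟨ cong ((x * length vs + y * length vs') +_) xa≡δ+yb ⟩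
      (x * length vs + y * length vs') + (δ + y * b) ≡⟨ push-in x y (length vs) (length vs') b δ ⟩
      (x * length vs + y * (length vs' + b)) + δ ≡⟨ cong (λ l → x * length vs + y * l + δ) len' ⟨
      (x * length vs + y * length ws') + δ   ≡⟨ cong (_+ δ) (length-mix vs ws') ⟨
      length (copies x vs ++ copies y ws') + δ ∎
      where
      pull-out : ∀ x y l a l' → x * (l + a) + y * l' ≡ (x * l + y * l') + x * a
      pull-out = solve-∀
      push-in : ∀ x y l l' b δ → (x * l + y * l') + (δ + y * b) ≡ (x * l + y * (l' + b)) + δ
      push-in = solve-∀

  -- First trade: V E = U^(q₁+1) G 1 (c₂-1), of lengths 2 and q₁ + 2.
  trade-q₁ : Trade q₁
  trade-q₁ = vs , ws , V-atom ∷ E-atom ∷ [] , ++⁺ (replicate⁺ (suc q₁) U-atom) (G-atom 1 c₂' refl ∷ []) ,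
             sums , lengths
    where
    vs ws : List Mult
    vs = V ∷ E ∷ []
    ws = replicate (suc q₁) U ++ G 1 c₂' ∷ []
    e-part : ∀ c₁' c₂' q₁ → c₁' + ((1 + c₁') + (1 + q₁ * (1 + c₁')) * (1 + c₂'))
                          ≡ (1 + q₁) * (1 + c₁') + ((1 + c₁') + (1 + q₁ * (1 + c₁')) * c₂')
    e-part = solve-∀
    g-part : ∀ c₂' q₁ → (1 + c₂') + (1 + q₁ * (1 + c₂')) + 0 ≡ (1 + q₁) * (1 + c₂') + 1
    g-part = solve-∀
    sums : sumₘ vs ≡ sumₘ ws
    sums = begin
      V ⊕ (E ⊕ 𝟘)                         ≡⟨ cong (V ⊕_) (⊕-identityʳ E) ⟩
      V ⊕ E                               ≡⟨ mult-≡ (e-part c₁' c₂' q₁) (g-part c₂' q₁) (cong (_+ 0) (sym (*-zeroʳ (suc q₁)))) ⟩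
      suc q₁ ⊛ U ⊕ G 1 c₂'                ≡⟨ cong₂ _⊕_ (sumₘ-replicate (suc q₁) U) (⊕-identityʳ (G 1 c₂')) ⟨
      sumₘ (replicate (suc q₁) U) ⊕ sumₘ (G 1 c₂' ∷ []) ≡⟨ sumₘ-++ (replicate (suc q₁) U) (G 1 c₂' ∷ []) ⟨
      sumₘ ws                             ∎
      where open ≡-Reasoning
    lengths : length ws ≡ 2 + q₁
    lengths = trans (List.length-++ (replicate (suc q₁) U))
                    (trans (cong (_+ 1) (List.length-replicate (suc q₁))) (+-comm (suc q₁) 1))

  -- Second trade: with d = j + rc₂ (0 ≤ j < c₂), ρ = c₂ - j and
  -- z = r + 1 - q₂, W E^z = H U^r G j ρ, of lengths z + 1 and z + 1 + q₂.
  trade-q₂ : Trade q₂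
  trade-q₂ = vs , ws , W-atom ∷ replicate⁺ z E-atom ,
             H-atom ∷ ++⁺ (replicate⁺ r U-atom) (G-atom j ρ j+ρ≡c₂ ∷ []) , sums , lengths
    where
    r j ρ z : ℕ
    r = d / c₂
    j = d % c₂
    ρ = c₂ ∸ j
    z = suc r ∸ q₂
    d≡j+rc₂ : d ≡ j + r * c₂
    d≡j+rc₂ = m≡m%n+[m/n]*n d c₂
    j+ρ≡c₂ : j + ρ ≡ c₂
    j+ρ≡c₂ = m+[n∸m]≡n (<⇒≤ (m%n<n d c₂))
    q₂≤r : q₂ ≤ r
    q₂≤r = s≤s⁻¹ (*-cancelʳ-< c₂ q₂ (suc r) (<-trans q₂c₂<d (begin-strict
      d           ≡⟨ d≡j+rc₂ ⟩
      j + r * c₂  <⟨ +-monoˡ-< (r * c₂) (m%n<n d c₂) ⟩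
      suc r * c₂  ∎)))
      where open ≤-Reasoning
    z+q₂≡1+r : z + q₂ ≡ suc r
    z+q₂≡1+r = m∸n+n≡m (≤-trans q₂≤r (n≤1+n r))
    vs ws : List Mult
    vs = W ∷ replicate z E
    ws = H ∷ (replicate r U ++ G j ρ ∷ [])
    c₁+kc₂≡n : c₁ + k * c₂ ≡ n
    c₁+kc₂≡n = trans (cong (c₁ +_) (*-comm k c₂)) (sym n≡c₁+c₂k)
    -- Both sides of the e-component, increased by q₂n, equal (1 + r)n.
    e-part : z * (c₁ + k * c₂) ≡ d + (r * c₁ + (c₁ + k * ρ))
    e-part = +-cancelʳ-≡ (q₂ * n) _ _ (begin
      z * (c₁ + k * c₂) + q₂ * n              ≡⟨ cong (λ N → z * N + q₂ * n) c₁+kc₂≡n ⟩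
      z * n + q₂ * n                          ≡⟨ *-distribʳ-+ n z q₂ ⟨
      (z + q₂) * n                            ≡⟨ cong (_* n) z+q₂≡1+r ⟩
      suc r * n                               ≡⟨ cong (λ N → suc r * N) c₁+kc₂≡n ⟨
      suc r * (c₁ + k * c₂)                   ≡⟨ cong (λ C → suc r * (c₁ + k * C)) j+ρ≡c₂ ⟨
      suc r * (c₁ + k * (j + ρ))              ≡⟨ collect k j r ρ c₁ ⟨
      k * (j + r * (j + ρ)) + (r * c₁ + (c₁ + k * ρ)) ≡⟨ cong (λ C → k * (j + r * C) + (r * c₁ + (c₁ + k * ρ))) j+ρ≡c₂ ⟩
      k * (j + r * c₂) + (r * c₁ + (c₁ + k * ρ)) ≡⟨ cong (λ D → k * D + (r * c₁ + (c₁ + k * ρ))) d≡j+rc₂ ⟨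
      k * d + (r * c₁ + (c₁ + k * ρ))         ≡⟨ cong (_+ (r * c₁ + (c₁ + k * ρ))) kd≡d+q₂n ⟩
      d + q₂ * n + (r * c₁ + (c₁ + k * ρ))    ≡⟨ +-CS.xy∙z≈xz∙y d (q₂ * n) _ ⟩
      d + (r * c₁ + (c₁ + k * ρ)) + q₂ * n    ∎)
      where
      open ≡-Reasoning
      collect : ∀ k j r ρ c₁ → k * (j + r * (j + ρ)) + (r * c₁ + (c₁ + k * ρ)) ≡ (1 + r) * (c₁ + k * (j + ρ))
      collect = solve-∀
    sums : sumₘ vs ≡ sumₘ ws
    sums = begin
      W ⊕ sumₘ (replicate z E)                ≡⟨ cong (W ⊕_) (sumₘ-replicate z E) ⟩
      W ⊕ z ⊛ E                               ≡⟨ mult-≡ e-part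
                                                  (trans (cong (d +_) (*-zeroʳ z)) (trans (+-identityʳ d) (trans d≡j+rc₂ (+-comm j (r * c₂)))))
                                                  (cong (t' +_) (trans (*-zeroʳ z) (sym (cong (_+ 0) (*-zeroʳ r))))) ⟩
      H ⊕ (r ⊛ U ⊕ G j ρ)                     ≡⟨ cong (λ v → H ⊕ (r ⊛ U ⊕ v)) (⊕-identityʳ (G j ρ)) ⟨
      H ⊕ (r ⊛ U ⊕ sumₘ (G j ρ ∷ []))         ≡⟨ cong (λ v → H ⊕ (v ⊕ sumₘ (G j ρ ∷ []))) (sumₘ-replicate r U) ⟨
      H ⊕ (sumₘ (replicate r U) ⊕ sumₘ (G j ρ ∷ [])) ≡⟨ cong (H ⊕_) (sumₘ-++ (replicate r U) (G j ρ ∷ [])) ⟨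
      sumₘ ws                                 ∎
      where open ≡-Reasoning
    lengths : length ws ≡ length vs + q₂
    lengths = begin
      suc (length (replicate r U ++ G j ρ ∷ [])) ≡⟨ cong suc (List.length-++ (replicate r U)) ⟩
      suc (length (replicate r U) + 1)        ≡⟨ cong (λ l → suc (l + 1)) (List.length-replicate r) ⟩
      suc (r + 1)                             ≡⟨ cong suc (+-comm r 1) ⟩
      suc (suc r)                             ≡⟨ cong suc z+q₂≡1+r ⟨
      suc (z + q₂)                            ≡⟨ cong (λ l → suc (l + q₂)) (List.length-replicate z) ⟨
      suc (length (replicate z E) + q₂)       ∎
      where open ≡-Reasoning

  m∈Δ : InΔG n G₀ m
  m∈Δ with Bézout.identity (gcd-GCD q₁ q₂)
  ... | Bézout.+- x y m+yq₂≡xq₁ = trade⇒m∈Δ (combine x y trade-q₁ trade-q₂ (sym m+yq₂≡xq₁))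
  ... | Bézout.-+ x y m+xq₁≡yq₂ = trade⇒m∈Δ (combine y x trade-q₂ trade-q₁ (sym m+xq₁≡yq₂))

  min-Δ : IsMinΔ n G₀ m
  min-Δ = inj₂ (m∈Δ , m≤Δ)

∸-∸-positive : ∀ n a b y → 1 ≤ y → y ≡ n ∸ a ∸ b → n ≡ a + b + y
∸-∸-positive n a b y 1≤y y≡n∸a∸b =
  trans (sym (m+[n∸m]≡n a+b≤n)) (cong ((a + b) +_) (trans (sym (∸-+-assoc n a b)) (sym y≡n∸a∸b)))
  where
  a+b≤n : a + b ≤ n
  a+b≤n = <⇒≤ (m∸n≢0⇒n<m λ n∸[a+b]≡0 →
    <-irrefl refl (≤-trans 1≤y (≤-reflexive (trans y≡n∸a∸b (trans (∸-+-assoc n a b) n∸[a+b]≡0)))))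

div-exact : ∀ x q b → 1 ≤ b → x ≡ q * b → x div b ≡ q
div-exact x q (suc b) _ refl = m*n/n≡m q (suc b)

G₀-of : (n : ℕ) .{{_ : NonZero n}} → ℕ → ℕ → ℕ → List ℕ
G₀-of n K d e = e ∷ mul n K e ∷ mul n d e ∷ []

Conclusion : (n : ℕ) .{{_ : NonZero n}} → ℕ → ℕ → ℕ → ℕ → Set
Conclusion n K d e m =
  IsGen n (mul n K e) × IsSubset n (G₀-of n K d e) × ExactlyTwoGens n (G₀-of n K d e) ×
  IsMinΔ n (G₀-of n K d e) m

theorem-for-generator : (n : ℕ) .{{_ : NonZero n}} → ∀ c₁ c₂ d e → InM n c₁ c₂ d → IsGen n e →
  Conclusion n ((n ∸ c₁) div c₂) d e (gcdM n c₁ c₂ d)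
theorem-for-generator n c₁ c₂ d e (_ , _ , (_ , divides zero n≡0) , _) _ = ⊥-elim (≢-nonZero⁻¹ n n≡0)
theorem-for-generator n c₁@(suc c₁') c₂@(suc c₂') d@(suc d') e
  ((s≤s z≤n , _) , (s≤s z≤n , _) , (s≤s z≤n , divides (suc t') n≡td) ,
   (q₁@(suc q₁') , s≤s z≤n , q₁c₁c₂≡) , (q₂@(suc q₂') , s≤s z≤n , q₂c₂n≡)) (e<n , gcd[e,n]≡1) =
  subst₂ (λ K m → Conclusion n K d e m) (sym K≡k) (sym gcdM≡m)
    (S.g-generates , S.G₀-subset , S.G₀-two-generators , S.min-Δ)
  where
  open ≡-Reasoning
  n≡ : n ≡ c₁ + c₂ + q₁ * c₁ * c₂
  n≡ = trans (∸-∸-positive n c₁ c₂ (q₁ * (c₁ * c₂)) (s≤s z≤n) q₁c₁c₂≡)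
             (cong (c₁ + c₂ +_) (sym (*-assoc q₁ c₁ c₂)))
  q₂n≡ : q₂ * n ≡ q₁ * c₁ * d
  q₂n≡ = *-cancelˡ-≡ (q₂ * n) (q₁ * c₁ * d) c₂ (begin
    c₂ * (q₂ * n)       ≡⟨ *-CS.x∙yz≈y∙xz c₂ q₂ n ⟩
    q₂ * (c₂ * n)       ≡⟨ q₂c₂n≡ ⟩
    (n ∸ c₁ ∸ c₂) * d   ≡⟨ cong (_* d) q₁c₁c₂≡ ⟨
    q₁ * (c₁ * c₂) * d  ≡⟨ rearrange q₁ c₁ c₂ d ⟩
    c₂ * (q₁ * c₁ * d)  ∎)
    where
    rearrange : ∀ q₁ c₁ c₂ d → q₁ * (c₁ * c₂) * d ≡ c₂ * (q₁ * c₁ * d)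
    rearrange = solve-∀
  module S = Setting n c₁' c₂' d' q₁' q₂' t' e n≡ n≡td q₂n≡ e<n gcd[e,n]≡1
  K≡k : (n ∸ c₁) div c₂ ≡ S.k
  K≡k = div-exact (n ∸ c₁) S.k c₂ (s≤s z≤n)
    (trans (cong (_∸ c₁) S.n≡c₁+c₂k) (trans (m+n∸m≡n c₁ (c₂ * S.k)) (*-comm c₂ S.k)))
  gcdM≡m : gcdM n c₁ c₂ d ≡ S.m
  gcdM≡m = cong₂ gcd (div-exact _ q₁ (c₁ * c₂) (s≤s z≤n) (sym q₁c₁c₂≡))
                     (div-exact _ q₂ (c₂ * n) (≤-trans (>-nonZero⁻¹ n) (m≤m+n n (c₂' * n))) (sym q₂c₂n≡))

-- M(n) is empty unless n ≥ 2, so then 1 generates ℤ/nℤ.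
1-generates : ∀ n {c₁ c₂ d} → InM n c₁ c₂ d → IsGen n 1
1-generates n {suc c₁'} {suc c₂'} (_ , _ , _ , (q₁ , 1≤q₁ , q₁c₁c₂≡) , _) = 1<n , gcd-zeroˡ n
  where
  1<n : 1 < n
  1<n = subst (1 <_)
    (sym (∸-∸-positive n (suc c₁') (suc c₂') _ (≤-trans 1≤q₁ (m≤m*n q₁ (suc c₁' * suc c₂'))) q₁c₁c₂≡))
    (s≤s (≤-trans (s≤s z≤n) (≤-trans (m≤n+m (suc c₂') c₁') (m≤m+n _ _))))

proposition6p3 : (n : ℕ) .{{_ : NonZero n}} →
    ((m : ℕ) → InI n m →
      Σ (List ℕ) λ G₀ → IsSubset n G₀ × ExactlyTwoGens n G₀ × IsMinΔ n G₀ m)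
    ×
    ((c₁ c₂ d e : ℕ) → InM n c₁ c₂ d → IsGen n e →
      IsGen n (mul n ((n ∸ c₁) div c₂) e) ×
      IsMinΔ n (e ∷ mul n ((n ∸ c₁) div c₂) e ∷ mul n d e ∷ []) (gcdM n c₁ c₂ d))
proposition6p3 n = every-m∈I , every-generator
  where
  every-m∈I : (m : ℕ) → InI n m → Σ (List ℕ) λ G₀ → IsSubset n G₀ × ExactlyTwoGens n G₀ × IsMinΔ n G₀ m
  every-m∈I m (c₁ , c₂ , d , c₁c₂d∈M , m≡gcdM) =
    let _ , subset , two-gens , min-Δ = theorem-for-generator n c₁ c₂ d 1 c₁c₂d∈M (1-generates n c₁c₂d∈M)
    in G₀-of n ((n ∸ c₁) div c₂) d 1 , subset , two-gens , subst (IsMinΔ n _) (sym m≡gcdM) min-Δ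

  every-generator : (c₁ c₂ d e : ℕ) → InM n c₁ c₂ d → IsGen n e →
    IsGen n (mul n ((n ∸ c₁) div c₂) e) × IsMinΔ n (G₀-of n ((n ∸ c₁) div c₂) d e) (gcdM n c₁ c₂ d)
  every-generator c₁ c₂ d e c₁c₂d∈M e-generates =
    let Ke-generates , _ , _ , min-Δ = theorem-for-generator n c₁ c₂ d e c₁c₂d∈M e-generates
    in Ke-generates , min-Δ
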